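{- Let $c_1,\dots,c_n>0$ and $p_1,\dots,p_n\in(0,1)$, and let $S^*\subseteq[n]$ be a subset maximizing $\big(\sum_{i\in S}c_i\big)\prod_{j\in S}p_j$ over all $S\subseteq[n]$, with optimal value $\mathrm{OPT}$. Let $\epsilon>0$. Then for every $\kappa$ with $0<\kappa\leq\frac{\epsilon\max_{i\in S^*}p_ic_i}{n}$, setting $\hat c_i=\lfloor c_i/\kappa\rfloor$ for $i\in[n]$ and \[ \hat z(n,n+1)=\max_{S\subseteq[n]}\Big(\sum_{i\in S}\hat c_i\Big)\prod_{j\in S}p_j, \] we have \[ \kappa\cdot\hat z(n,n+1)\geq(1-\epsilon)\cdot\mathrm{OPT}. \]
   Context: In the paper $\hat z(n,n+1)$ is computed by a dynamic program as $\max_C C\cdot\hat P(n,C)$, where $\hat P(n,C)$ is the maximum of $\prod_{j\in S}p_j$ over subsets $S\subseteq[n]$ with $\sum_{i\in S}\hat c_i=C$; this equals the maximum over subsets stated above. $\mathrm{OPT}$ equals $C^*P(n,C^*)$ where $C^*=\sum_{i\in S^*}c_i$ and $P(n,C^*)=\prod_{j\in S^*}p_j$.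
   Formalization: The numbers $c_1,\dots,c_n$, $p_1,\dots,p_n$, $\epsilon$ and $\kappa$ are rational. -}

module Defs where

open import Data.Bool using (Bool; true; false; if_then_else_)
open import Data.Nat using (ℕ; zero; suc)
open import Data.Fin using (Fin; zero; suc)
open import Data.Vec using (Vec; []; _∷_)
open import Data.Integer using (ℤ)
open import Data.Rational using (ℚ; 0ℚ; 1ℚ; _+_; _*_; _⊔_; _<_; _÷_; floor; >-nonZero; _/_)
open import Function using (_∘_)

-- A subset S ⊆ [n] is a characteristic vector (true = i ∈ S), as Data.Fin.Subset.
Subset : ℕ → Set
Subset = Vec Bool

sumOver : ∀ {n} → Subset n → (Fin n → ℚ) → ℚ
sumOver {zero} [] f = 0ℚ
sumOver {suc n} (b ∷ S) f = (if b then f zero else 0ℚ) + sumOver S (f ∘ suc)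

prodOver : ∀ {n} → Subset n → (Fin n → ℚ) → ℚ
prodOver {zero} [] f = 1ℚ
prodOver {suc n} (b ∷ S) f = (if b then f zero else 1ℚ) * prodOver S (f ∘ suc)

-- max_{i ∈ S} f i  (value 0 for the empty set; only used for nonempty S)
maxOver : ∀ {n} → Subset n → (Fin n → ℚ) → ℚ
maxOver {zero} [] f = 0ℚ
maxOver {suc n} (false ∷ S) f = maxOver S (f ∘ suc)
maxOver {suc n} (true ∷ S) f = f zero ⊔ maxOver S (f ∘ suc)

obj : ∀ {n} → (Fin n → ℚ) → (Fin n → ℚ) → Subset n → ℚ
obj c p S = sumOver S c * prodOver S p

chat : (κ : ℚ) → 0ℚ < κ → ℚ → ℤ
chat κ κpos x = floor ((x ÷ κ) {{>-nonZero κpos}})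

chatQ : ∀ {n} → (κ : ℚ) → 0ℚ < κ → (Fin n → ℚ) → Fin n → ℚ
chatQ κ κpos c i = chat κ κpos (c i) / 1

module Submission where

open import Defs
open import Data.Nat using (ℕ)
open import Data.Fin using (Fin)
open import Data.Integer using (+_)
open import Data.Product using (_×_)
open import Data.Rational using (ℚ; 0ℚ; 1ℚ; _*_; _-_; _<_; _≤_; _/_)

open import Data.Bool using (true; false)
open import Data.Vec using ([]; _∷_)
open import Data.Fin using (zero; suc)
open import Data.Nat as ℕ using (suc)
import Data.Nat.Properties as ℕ
import Data.Nat.Coprimality as Coprime
import Data.Integer as ℤ
import Data.Integer.Properties as ℤ
import Data.Integer.DivMod as ℤ
open import Data.Rational using (mkℚ; *≤*; floor; _÷_; 1/_; >-nonZero; _+_; -_; nonNegative)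
open import Data.Rational.Properties
open import Data.Rational.Solver using (module +-*-Solver)
open import Data.Product using (_,_; proj₁; proj₂)
open import Relation.Binary.PropositionalEquality
open import Function using (_∘_)
open import Algebra.Bundles using (CommutativeMonoid)
open import Algebra.Properties.CommutativeSemigroup
  (CommutativeMonoid.commutativeSemigroup +-0-commutativeMonoid)
  using () renaming (interchange to +-interchange)

-- Write C = Σ_{i∈S*} c_i, P = Π_{j∈S*} p_j, Ĉ = Σ_{i∈S*} ĉ_i and
-- M = max_{i∈S*} p_i c_i.  Rounding down loses less than one unit per item:
-- c_i ≤ κ ĉ_i + κ, so C ≤ κ Ĉ + κ n ≤ κ Ĉ + ε M.  Since every p_i ≤ 1 and
-- c_i ≥ 0, M ≤ C, and therefore (1 - ε) C ≤ C - ε M ≤ κ Ĉ.  Multiplying by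
-- P ≥ 0 gives (1 - ε) OPT ≤ κ · Ĉ P, and Ĉ P is the rounded objective of S*,
-- which is at most the rounded optimum attained by Ŝ.

int/1≡mkℚ : ∀ i → i / 1 ≡ mkℚ i 0 (Coprime.sym (Coprime.1-coprimeTo _))
int/1≡mkℚ i = ↥p/↧p≡p (mkℚ i 0 (Coprime.sym (Coprime.1-coprimeTo _)))

int/1-+1 : ∀ i → i / 1 + 1ℚ ≡ (i ℤ.+ ℤ.1ℤ) / 1
int/1-+1 i rewrite int/1≡mkℚ i = cong (_/ 1) (cong (ℤ._+ ℤ.1ℤ) (ℤ.*-identityʳ i))

nat/1-suc : ∀ n → + suc n / 1 ≡ + n / 1 + 1ℚ
nat/1-suc n rewrite int/1-+1 (+ n) = cong (λ k → + k / 1) (ℕ.+-comm 1 n)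

-- x ≤ ⌊x⌋ + 1: with x = a/d and a = r + q d (0 ≤ r < d, q = ⌊x⌋) we get a ≤ (q + 1) d.
≤floor+1 : ∀ x → x ≤ floor x / 1 + 1ℚ
≤floor+1 x@(mkℚ a d-1 _) rewrite int/1-+1 (floor x) | int/1≡mkℚ (floor x ℤ.+ ℤ.1ℤ) =
  *≤* (begin
    a ℤ.* + 1               ≡⟨ ℤ.*-identityʳ a ⟩
    a                       ≡⟨ ℤ.a≡a%n+[a/n]*n a d ⟩
    + r ℤ.+ q ℤ.* d         ≤⟨ ℤ.+-monoˡ-≤ (q ℤ.* d) (ℤ.<⇒≤ (ℤ.+<+ (ℤ.n%d<d a d))) ⟩
    d ℤ.+ q ℤ.* d           ≡⟨ cong (ℤ._+ q ℤ.* d) (sym (ℤ.*-identityˡ d)) ⟩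
    ℤ.1ℤ ℤ.* d ℤ.+ q ℤ.* d  ≡⟨ sym (ℤ.*-distribʳ-+ d ℤ.1ℤ q) ⟩
    (ℤ.1ℤ ℤ.+ q) ℤ.* d      ≡⟨ cong (ℤ._* d) (ℤ.+-comm ℤ.1ℤ q) ⟩
    (q ℤ.+ ℤ.1ℤ) ℤ.* d      ∎)
  where
  open ℤ.≤-Reasoning
  d = + suc d-1
  q = a ℤ./ d
  r = a ℤ.% d

≤κ*chat+κ : ∀ κ (κpos : 0ℚ < κ) x → x ≤ κ * (chat κ κpos x / 1) + κ
≤κ*chat+κ κ κpos x = begin
  x                              ≡⟨ sym κ*[x÷κ]≡x ⟩
  κ * y                          ≤⟨ *-monoˡ-≤-nonNeg κ {{nonNegative (<⇒≤ κpos)}} (≤floor+1 y) ⟩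
  κ * (floor y / 1 + 1ℚ)         ≡⟨ *-distribˡ-+ κ (floor y / 1) 1ℚ ⟩
  κ * (floor y / 1) + κ * 1ℚ     ≡⟨ cong (λ z → κ * (floor y / 1) + z) (*-identityʳ κ) ⟩
  κ * (chat κ κpos x / 1) + κ    ∎
  where
  open ≤-Reasoning
  instance κ≢0 = >-nonZero κpos
  y = x ÷ κ
  κ*[x÷κ]≡x : κ * y ≡ x
  κ*[x÷κ]≡x = begin-equality
    κ * (x * 1/ κ)   ≡⟨ cong (κ *_) (*-comm x (1/ κ)) ⟩
    κ * (1/ κ * x)   ≡⟨ sym (*-assoc κ (1/ κ) x) ⟩
    (κ * 1/ κ) * x   ≡⟨ cong (_* x) (*-inverseʳ κ) ⟩
    1ℚ * x           ≡⟨ *-identityˡ x ⟩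
    x                ∎

sumOver-mono : ∀ {n} (S : Subset n) {f g : Fin n → ℚ} →
               (∀ i → f i ≤ g i) → sumOver S f ≤ sumOver S g
sumOver-mono []          f≤g = ≤-refl
sumOver-mono (true ∷ S)  f≤g = +-mono-≤ (f≤g zero) (sumOver-mono S (f≤g ∘ suc))
sumOver-mono (false ∷ S) f≤g = +-monoʳ-≤ 0ℚ (sumOver-mono S (f≤g ∘ suc))

sumOver-+ : ∀ {n} (S : Subset n) (f g : Fin n → ℚ) →
            sumOver S (λ i → f i + g i) ≡ sumOver S f + sumOver S g
sumOver-+ []          f g = refl
sumOver-+ (true ∷ S)  f g rewrite sumOver-+ S (f ∘ suc) (g ∘ suc) =
  +-interchange (f zero) (g zero) (sumOver S (f ∘ suc)) (sumOver S (g ∘ suc))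
sumOver-+ (false ∷ S) f g rewrite sumOver-+ S (f ∘ suc) (g ∘ suc)
                                | +-identityˡ (sumOver S (f ∘ suc))
                                | +-identityˡ (sumOver S (g ∘ suc)) = +-identityˡ _

sumOver-scale : ∀ {n} (S : Subset n) (a : ℚ) (f : Fin n → ℚ) →
                sumOver S (λ i → a * f i) ≡ a * sumOver S f
sumOver-scale []          a f = sym (*-zeroʳ a)
sumOver-scale (true ∷ S)  a f rewrite sumOver-scale S a (f ∘ suc) =
  sym (*-distribˡ-+ a (f zero) (sumOver S (f ∘ suc)))
sumOver-scale (false ∷ S) a f rewrite sumOver-scale S a (f ∘ suc) =
  trans (+-identityˡ _) (cong (a *_) (sym (+-identityˡ _)))

≤+nonNeg : ∀ a {b} → 0ℚ ≤ b → a ≤ a + b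
≤+nonNeg a {b} 0≤b = ≤-trans (≤-reflexive (sym (+-identityʳ a))) (+-monoʳ-≤ a 0≤b)

≤nonNeg+ : ∀ {a} b → 0ℚ ≤ a → b ≤ a + b
≤nonNeg+ {a} b 0≤a = ≤-trans (≤+nonNeg b 0≤a) (≤-reflexive (+-comm b a))

size≤n : ∀ {n} (S : Subset n) → sumOver S (λ _ → 1ℚ) ≤ + n / 1
size≤n []                = ≤-refl
size≤n {suc n} (true ∷ S) rewrite nat/1-suc n =
  ≤-trans (≤-reflexive (+-comm 1ℚ (sumOver S (λ _ → 1ℚ)))) (+-monoˡ-≤ 1ℚ (size≤n S))
size≤n {suc n} (false ∷ S) rewrite nat/1-suc n =
  ≤-trans (≤-reflexive (+-identityˡ _))
          (≤-trans (size≤n S) (≤+nonNeg (+ n / 1) (*≤* (ℤ.+≤+ ℕ.z≤n))))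

sumOver-nonNeg : ∀ {n} (S : Subset n) (f : Fin n → ℚ) → (∀ i → 0ℚ ≤ f i) → 0ℚ ≤ sumOver S f
sumOver-nonNeg []          f f≥0 = ≤-refl
sumOver-nonNeg (true ∷ S)  f f≥0 =
  ≤-trans (f≥0 zero) (≤+nonNeg (f zero) (sumOver-nonNeg S (f ∘ suc) (f≥0 ∘ suc)))
sumOver-nonNeg (false ∷ S) f f≥0 =
  ≤-trans (sumOver-nonNeg S (f ∘ suc) (f≥0 ∘ suc)) (≤-reflexive (sym (+-identityˡ _)))

prodOver-nonNeg : ∀ {n} (S : Subset n) (f : Fin n → ℚ) → (∀ i → 0ℚ ≤ f i) → 0ℚ ≤ prodOver S f
prodOver-nonNeg []          f f≥0 = *≤* (ℤ.+≤+ ℕ.z≤n)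
prodOver-nonNeg (true ∷ S)  f f≥0 =
  nonNegative⁻¹ _ {{nonNeg*nonNeg⇒nonNeg (f zero) {{nonNegative (f≥0 zero)}} _
                    {{nonNegative (prodOver-nonNeg S (f ∘ suc) (f≥0 ∘ suc))}}}}
prodOver-nonNeg (false ∷ S) f f≥0 =
  ≤-trans (prodOver-nonNeg S (f ∘ suc) (f≥0 ∘ suc)) (≤-reflexive (sym (*-identityˡ _)))

maxOver≤sumOver : ∀ {n} (S : Subset n) (f : Fin n → ℚ) → (∀ i → 0ℚ ≤ f i) →
                  maxOver S f ≤ sumOver S f
maxOver≤sumOver []          f f≥0 = ≤-refl
maxOver≤sumOver (true ∷ S)  f f≥0 =
  ⊔-lub (≤+nonNeg (f zero) (sumOver-nonNeg S (f ∘ suc) (f≥0 ∘ suc)))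
        (≤-trans (maxOver≤sumOver S (f ∘ suc) (f≥0 ∘ suc)) (≤nonNeg+ _ (f≥0 zero)))
maxOver≤sumOver (false ∷ S) f f≥0 =
  ≤-trans (maxOver≤sumOver S (f ∘ suc) (f≥0 ∘ suc)) (≤-reflexive (sym (+-identityˡ _)))

rounding-loss : ∀ {n} κ (κpos : 0ℚ < κ) (c : Fin n → ℚ) (S : Subset n) →
                sumOver S c ≤ κ * sumOver S (chatQ κ κpos c) + κ * (+ n / 1)
rounding-loss {n} κ κpos c S = begin
  sumOver S c                               ≤⟨ sumOver-mono S per-item ⟩
  sumOver S (λ i → κ * ĉ i + κ * 1ℚ)        ≡⟨ sumOver-+ S (λ i → κ * ĉ i) (λ _ → κ * 1ℚ) ⟩
  sumOver S (λ i → κ * ĉ i) + sumOver S (λ _ → κ * 1ℚ)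
    ≡⟨ cong₂ _+_ (sumOver-scale S κ ĉ) (sumOver-scale S κ (λ _ → 1ℚ)) ⟩
  κ * sumOver S ĉ + κ * sumOver S (λ _ → 1ℚ)
    ≤⟨ +-monoʳ-≤ (κ * sumOver S ĉ) (*-monoˡ-≤-nonNeg κ {{nonNegative (<⇒≤ κpos)}} (size≤n S)) ⟩
  κ * sumOver S ĉ + κ * (+ n / 1)           ∎
  where
  open ≤-Reasoning
  ĉ : Fin n → ℚ
  ĉ = chatQ κ κpos c
  per-item : ∀ i → c i ≤ κ * ĉ i + κ * 1ℚ
  per-item i rewrite *-identityʳ κ = ≤κ*chat+κ κ κpos (c i)

maxOver-weighted≤sumOver : ∀ {n} (S : Subset n) (c p : Fin n → ℚ) →
                           (∀ i → 0ℚ ≤ c i) → (∀ i → 0ℚ ≤ p i × p i ≤ 1ℚ) →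
                           maxOver S (λ i → p i * c i) ≤ sumOver S c
maxOver-weighted≤sumOver S c p c≥0 0≤p≤1 =
  ≤-trans (maxOver≤sumOver S (λ i → p i * c i) pc≥0) (sumOver-mono S pc≤c)
  where
  pc≥0 : ∀ i → 0ℚ ≤ p i * c i
  pc≥0 i = nonNegative⁻¹ _ {{nonNeg*nonNeg⇒nonNeg (p i) {{nonNegative (proj₁ (0≤p≤1 i))}}
                                                  (c i) {{nonNegative (c≥0 i)}}}}
  pc≤c : ∀ i → p i * c i ≤ c i
  pc≤c i = ≤-trans (*-monoʳ-≤-nonNeg (c i) {{nonNegative (c≥0 i)}} (proj₂ (0≤p≤1 i)))
                   (≤-reflexive (*-identityˡ (c i)))

loss-bound : ∀ {C a b ε M} → 0ℚ ≤ ε → M ≤ C → b ≤ ε * M → C ≤ a + b → (1ℚ - ε) * C ≤ a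
loss-bound {C} {a} {b} {ε} {M} ε≥0 M≤C b≤εM C≤a+b = begin
  (1ℚ - ε) * C  ≡⟨ solve 2 (λ ε C → (con 1ℚ :- ε) :* C := C :- ε :* C) refl ε C ⟩
  C - ε * C     ≤⟨ +-monoʳ-≤ C (neg-antimono-≤ (*-monoˡ-≤-nonNeg ε {{nonNegative ε≥0}} M≤C)) ⟩
  C - ε * M     ≤⟨ +-monoʳ-≤ C (neg-antimono-≤ b≤εM) ⟩
  C - b         ≤⟨ +-monoˡ-≤ (- b) C≤a+b ⟩
  (a + b) - b   ≡⟨ solve 2 (λ a b → (a :+ b) :- b := a) refl a b ⟩
  a             ∎
  where
  open ≤-Reasoning
  open +-*-Solver

lemma5 : (n : ℕ) (c p : Fin n → ℚ)
    → (∀ i → 0ℚ < c i)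
    → (∀ i → 0ℚ < p i × p i < 1ℚ)
    → (S* : Subset n) → (∀ S → obj c p S ≤ obj c p S*)
    → (ε : ℚ) → 0ℚ < ε
    → (κ : ℚ) (κpos : 0ℚ < κ)
    → κ * ((+ n) / 1) ≤ ε * maxOver S* (λ i → p i * c i)
    → (Ŝ : Subset n) → (∀ S → obj (chatQ κ κpos c) p S ≤ obj (chatQ κ κpos c) p Ŝ)
    → (1ℚ - ε) * obj c p S* ≤ κ * obj (chatQ κ κpos c) p Ŝ
lemma5 n c p c>0 0<p<1 S* _ ε ε>0 κ κpos κn≤εM Ŝ Ŝ-optimal = begin
  (1ℚ - ε) * (C * P)   ≡⟨ sym (*-assoc (1ℚ - ε) C P) ⟩
  ((1ℚ - ε) * C) * P   ≤⟨ *-monoʳ-≤-nonNeg P {{nonNegative P≥0}} [1-ε]C≤κĈ ⟩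
  (κ * Ĉ) * P          ≡⟨ *-assoc κ Ĉ P ⟩
  κ * (Ĉ * P)          ≤⟨ *-monoˡ-≤-nonNeg κ {{nonNegative (<⇒≤ κpos)}} (Ŝ-optimal S*) ⟩
  κ * obj (chatQ κ κpos c) p Ŝ ∎
  where
  open ≤-Reasoning
  C = sumOver S* c
  P = prodOver S* p
  Ĉ = sumOver S* (chatQ κ κpos c)
  0≤p≤1 : ∀ i → 0ℚ ≤ p i × p i ≤ 1ℚ
  0≤p≤1 i = <⇒≤ (proj₁ (0<p<1 i)) , <⇒≤ (proj₂ (0<p<1 i))
  P≥0 : 0ℚ ≤ P
  P≥0 = prodOver-nonNeg S* p (proj₁ ∘ 0≤p≤1)
  [1-ε]C≤κĈ : (1ℚ - ε) * C ≤ κ * Ĉ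
  [1-ε]C≤κĈ = loss-bound (<⇒≤ ε>0)
                (maxOver-weighted≤sumOver S* c p (λ i → <⇒≤ (c>0 i)) 0≤p≤1)
                κn≤εM
                (rounding-loss κ κpos c S*)
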